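{- Let $n>11$ be an integer, $r=n-4$, let $G$ be an $r$-regular graph with $V(G)=\{v_1,\dots,v_n\}$ and $E(G)=\{e_1,\dots,e_m\}$, and let $H$ be the bipartite graph constructed from $G$ as in the context. Let $k$ be a positive integer with $k<n/2$, and let $x=m-\left(kr-\binom{k}{2}\right)$. If $G$ contains no clique of size $k$, then no independent set of $k+x$ vertices in $H$ covers $kr+x(r-1)$ or more edges of $H$.
   Context: Construction of $H$: $H$ is bipartite with parts $A=\{a_1,\dots,a_m\}$ and $B=\beta\cup\Pi$, where $\beta=\{b_1,\dots,b_n\}$ and $\Pi=\{p_{i,j}: i\in[m], j\in[r-3]\}$; $E(H)=\{a_ip_{i,j}: i\in[m], j\in[r-3]\}\cup\{a_ib_j: e_i \text{ is incident to } v_j \text{ in } G\}$. An edge is covered by a vertex set if at least one of its endpoints lies in the set. $[N]=\{1,\dots,N\}$. -}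

module Defs where

open import Data.Nat using (ℕ; zero; suc; _+_; _*_; _∸_)
open import Data.Nat.Combinatorics using (_C_)
open import Data.Bool using (Bool; true; false; _∧_; _∨_; if_then_else_)
open import Data.Fin using (Fin)
open import Data.Fin.Properties using (_≟_)
open import Data.List using (List; []; _∷_; map; _++_; allFin; cartesianProduct)
open import Data.Product using (_×_; _,_; proj₁; proj₂; Σ; ∃)
open import Data.Sum using (_⊎_; inj₁; inj₂)
open import Relation.Nullary using (¬_; does)
open import Relation.Binary.PropositionalEquality using (_≡_; _≢_)
open import Function.Definitions using (Injective)

-- A finite simple graph G with vertex set {v_1..v_n} = Fin n and an
-- enumeration of its edge set {e_1..e_m} = Fin m: edge i has endpoints
-- (end₁ i, end₂ i), distinct, and distinct indices give distinct edges.
record Graph (n m : ℕ) : Set where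
  field
    end₁ end₂ : Fin m → Fin n
    loopless  : ∀ i → end₁ i ≢ end₂ i
    noMulti   : ∀ i j →
      ((end₁ i ≡ end₁ j × end₂ i ≡ end₂ j) ⊎ (end₁ i ≡ end₂ j × end₂ i ≡ end₁ j)) →
      i ≡ j
open Graph public

count : {A : Set} → (A → Bool) → List A → ℕ
count p []       = 0
count p (x ∷ xs) = if p x then suc (count p xs) else count p xs

incidentᵇ : ∀ {n m} → Graph n m → Fin m → Fin n → Bool
incidentᵇ G i v = does (end₁ G i ≟ v) ∨ does (end₂ G i ≟ v)

degree : ∀ {n m} → Graph n m → Fin n → ℕ
degree {n} {m} G v = count (λ i → incidentᵇ G i v) (allFin m)

Regular : ∀ {n m} → Graph n m → ℕ → Set
Regular {n} G r = ∀ (v : Fin n) → degree G v ≡ r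

Adj : ∀ {n m} → Graph n m → Fin n → Fin n → Set
Adj {n} {m} G u v = ∃ λ (i : Fin m) →
  (end₁ G i ≡ u × end₂ G i ≡ v) ⊎ (end₁ G i ≡ v × end₂ G i ≡ u)

HasClique : ∀ {n m} → Graph n m → ℕ → Set
HasClique {n} G k = Σ (Fin k → Fin n) λ f →
  Injective _≡_ _≡_ f × (∀ i j → i ≢ j → Adj G (f i) (f j))

-- The bipartite graph H built from G (with parameter r: Π has indices
-- j ∈ [r-3]).  Part A = Fin m (a_i), part B = β ∪ Π where
-- β = Fin n (b_j) and Π = Fin m × Fin (r ∸ 3) (p_{i,j}).

HB : ℕ → ℕ → ℕ → Set
HB n m r = Fin n ⊎ (Fin m × Fin (r ∸ 3))

HV : ℕ → ℕ → ℕ → Set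
HV n m r = Fin m ⊎ HB n m r

allHB : ∀ n m r → List (HB n m r)
allHB n m r = map inj₁ (allFin n) ++ map inj₂ (cartesianProduct (allFin m) (allFin (r ∸ 3)))

allHV : ∀ n m r → List (HV n m r)
allHV n m r = map inj₁ (allFin m) ++ map inj₂ (allHB n m r)

HAdjᵇ : ∀ {n m} → Graph n m → (r : ℕ) → Fin m → HB n m r → Bool
HAdjᵇ G r i (inj₁ v)       = incidentᵇ G i v
HAdjᵇ G r i (inj₂ (i' , j)) = does (i ≟ i')

allAB : ∀ n m r → List (Fin m × HB n m r)
allAB n m r = cartesianProduct (allFin m) (allHB n m r)

VSet : ℕ → ℕ → ℕ → Set
VSet n m r = HV n m r → Bool

size : ∀ {n m r} → VSet n m r → ℕ
size {n} {m} {r} S = count S (allHV n m r)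

Independent : ∀ {n m} → Graph n m → (r : ℕ) → VSet n m r → Set
Independent G r S = ∀ i b → HAdjᵇ G r i b ≡ true →
  (S (inj₁ i) ∧ S (inj₂ b)) ≡ false

covered : ∀ {n m} → Graph n m → (r : ℕ) → VSet n m r → ℕ
covered {n} {m} G r S =
  count (λ { (i , b) → HAdjᵇ G r i b ∧ (S (inj₁ i) ∨ S (inj₂ b)) }) (allAB n m r)

module Submission where

-- Let S be an independent set of H with |S| = k + x covering at least
-- kr + x(r - 1) edges, and put X = S ∩ β, α = |S ∩ A|, β = |X|, π = |S ∩ Π|,
-- e = #(edges of G inside X), N = #(edges of G with no end in X).  Counting gives
--   |S| = α + β + π,   cov(S) ≤ (r - 1)α + rβ + π   (deg a_i = r - 1, deg b_v = r, deg p = 1),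
--   α ≤ N   (a_i ∈ S keeps both ends of e_i out of S),
--   2m = nr,   m + e = N + rβ,   2e ≤ rβ,   e ≤ (β choose 2),
-- and e < (k choose 2) if β = k, since G has no k-clique.  The size and cover
-- conditions force β ≥ k + (r - 2)π; with β = k + d the identities give
-- d + π + e = (k choose 2) + (N - α) + dr.  If d = 0 then π = 0 and e ≥ (k choose 2),
-- impossible; if d ≥ 1 then π ≤ 1, and writing r = k + s (s ≥ 3) either
-- e ≤ (k + d choose 2) fails (d ≤ s + 1) or 2e ≤ (k + d)r fails (d ≥ s + 2).

open import Defs
open import Data.Nat
  using (ℕ; zero; suc; _+_; _*_; _∸_; _≤_; _<_; _<ᵇ_; z≤n; s≤s; s≤s⁻¹; _≤?_)
open import Data.Nat.Properties
  using ( ≤-refl; ≤-trans; ≤-antisym; ≤-reflexive; ≤-<-trans; <⇒≤; <⇒≱; ≰⇒>; ≮⇒≥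
        ; n<1⇒n≡0; n<1+n; m≤m+n; m≤n+m; m+1+n≰m; m∸n≤m; m∸n+n≡m; m+[n∸m]≡n
        ; m≤n⇒∃[o]m+o≡n; +-assoc; +-identityʳ; +-mono-≤; +-monoˡ-≤; +-monoʳ-≤
        ; +-cancelˡ-≤; +-cancelʳ-≤; +-cancelˡ-≡; *-comm; *-assoc; *-identityˡ
        ; *-identityʳ; *-zeroʳ; *-distribˡ-+; *-distribʳ-+; *-monoˡ-≤; *-monoʳ-≤
        ; *-cancelˡ-≤; *-cancelˡ-<; +-*-semiring; module ≤-Reasoning )
open import Data.Nat.Combinatorics using (_C_; nC1≡n; nCk+nC[k+1]≡[n+1]C[k+1])
open import Data.Nat.Tactic.RingSolver using (solve-∀)
open import Data.Bool using (Bool; true; false; _∧_; _∨_; not)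
open import Data.Bool.Properties using (∧-comm; ∨-zeroʳ)
open import Data.Empty using (⊥; ⊥-elim)
open import Data.Fin using (Fin; zero; suc; toℕ)
open import Data.Fin.Properties using (_≟_; suc-injective; 0≢1+n)
open import Data.List using (List; []; _∷_; map; _++_; tabulate; allFin; cartesianProduct)
open import Data.Product using (Σ; ∃; _×_; _,_)
import Data.Product as Product
open import Data.Sum using (_⊎_; inj₁; inj₂)
open import Function using (_∘_; id)
open import Function.Definitions using (Injective)
open import Relation.Nullary using (¬_; Dec; does; yes; no)
open import Relation.Nullary.Decidable using (dec-true; _×-dec_; _⊎-dec_)
open import Relation.Binary.PropositionalEquality
open import Algebra.Properties.Semiring.Sum +-*-semiring
  using (sum; sum-syntax; sum-cong-≗; ∑-distrib-+; ∑-comm; *-distribˡ-sum; *-distribʳ-sum)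

𝟙 : Bool → ℕ
𝟙 true  = 1
𝟙 false = 0

𝟙≤1 : ∀ b → 𝟙 b ≤ 1
𝟙≤1 true  = ≤-refl
𝟙≤1 false = z≤n

𝟙-∧ : ∀ a b → 𝟙 (a ∧ b) ≡ 𝟙 a * 𝟙 b
𝟙-∧ true  b = sym (+-identityʳ (𝟙 b))
𝟙-∧ false b = refl

𝟙-does : ∀ {P : Set} (P? : Dec P) → 1 ≤ 𝟙 (does P?) → P
𝟙-does (yes p) _ = p

𝟙-∨ : ∀ a b → (1 ≤ 𝟙 a → 1 ≤ 𝟙 b → ⊥) → 𝟙 (a ∨ b) ≡ 𝟙 a + 𝟙 b
𝟙-∨ true  true  exclusive = ⊥-elim (exclusive ≤-refl ≤-refl)
𝟙-∨ true  false _         = refl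
𝟙-∨ false b     _         = refl

δ : ∀ {n} → Fin n → Fin n → ℕ
δ a b = 𝟙 (does (a ≟ b))

δ-sound : ∀ {n} {a b : Fin n} → 1 ≤ δ a b → a ≡ b
δ-sound {a = a} {b} = 𝟙-does (a ≟ b)

sum-mono : ∀ {n} {f g : Fin n → ℕ} → (∀ i → f i ≤ g i) → sum f ≤ sum g
sum-mono {zero}  _   = z≤n
sum-mono {suc n} f≤g = +-mono-≤ (f≤g zero) (sum-mono (f≤g ∘ suc))

sum-const : ∀ n c → ∑[ i < n ] c ≡ n * c
sum-const zero    c = refl
sum-const (suc n) c = cong (c +_) (sum-const n c)

sum-zero : ∀ {n} (f : Fin n → ℕ) → (∀ i → f i ≡ 0) → sum f ≡ 0
sum-zero {n} f f≡0 = trans (sum-cong-≗ f≡0) (trans (sum-const n 0) (*-zeroʳ n))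

sum-*ˡ : ∀ {n} c (f : Fin n → ℕ) → ∑[ i < n ] (c * f i) ≡ c * sum f
sum-*ˡ c f = sym (*-distribˡ-sum c f)

sum-δ : ∀ {n} (a : Fin n) (w : Fin n → ℕ) → ∑[ v < n ] (δ a v * w v) ≡ w a
sum-δ {suc n} zero w =
  trans (cong₂ _+_ (+-identityʳ (w zero)) (sum-zero {n} _ (λ _ → refl))) (+-identityʳ (w zero))
sum-δ {suc n} (suc a) w = sum-δ a (w ∘ suc)

sum-δ₂ : ∀ {n} (a b : Fin n) (f : Fin n → Fin n → ℕ) →
  ∑[ u < n ] ∑[ v < n ] (f u v * (δ a u * δ b v)) ≡ f a b
sum-δ₂ {n} a b f = begin
  ∑[ u < n ] ∑[ v < n ] (f u v * (δ a u * δ b v))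
    ≡⟨ sum-cong-≗ (λ u → sum-cong-≗ (λ v → regroup (f u v) (δ a u) (δ b v))) ⟩
  ∑[ u < n ] ∑[ v < n ] (δ a u * (δ b v * f u v))
    ≡⟨ sum-cong-≗ (λ u → sum-*ˡ (δ a u) (λ v → δ b v * f u v)) ⟩
  ∑[ u < n ] (δ a u * ∑[ v < n ] (δ b v * f u v))
    ≡⟨ sum-δ a _ ⟩
  ∑[ v < n ] (δ b v * f a v)
    ≡⟨ sum-δ b (f a) ⟩
  f a b ∎
  where
  open ≡-Reasoning
  regroup : ∀ x y z → x * (y * z) ≡ y * (z * x)
  regroup = solve-∀

sum-positive : ∀ {n} (f : Fin n → ℕ) → 1 ≤ sum f → ∃ λ i → 1 ≤ f i
sum-positive {suc n} f h with f zero in eq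
... | suc _ = zero , subst (1 ≤_) (sym eq) (s≤s z≤n)
... | zero  = Product.map suc id (sum-positive (f ∘ suc) h)

sum≤1 : ∀ {n} (f : Fin n → ℕ) → (∀ i → f i ≤ 1) →
  (∀ i j → 1 ≤ f i → 1 ≤ f j → i ≡ j) → sum f ≤ 1
sum≤1 {zero}  f _   _      = z≤n
sum≤1 {suc n} f f≤1 unique with f zero in eq
... | zero  = sum≤1 (f ∘ suc) (f≤1 ∘ suc) (λ i j p q → suc-injective (unique (suc i) (suc j) p q))
... | suc k = begin
  suc k + sum (f ∘ suc) ≡⟨ cong (suc k +_) (sum-zero (f ∘ suc) rest-vanishes) ⟩
  suc k + 0             ≡⟨ +-identityʳ (suc k) ⟩
  suc k                 ≡⟨ eq ⟨
  f zero                ≤⟨ f≤1 zero ⟩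
  1                     ∎
  where
  open ≤-Reasoning
  rest-vanishes : ∀ i → f (suc i) ≡ 0
  rest-vanishes i = n<1⇒n≡0 (≰⇒> λ fi≥1 →
    0≢1+n (unique zero (suc i) (subst (1 ≤_) (sym eq) (s≤s z≤n)) fi≥1))

sum-tight : ∀ {n} {f g : Fin n → ℕ} → (∀ i → f i ≤ g i) → sum g ≤ sum f → ∀ i → f i ≡ g i
sum-tight {suc n} {f} {g} f≤g g≤f zero = ≤-antisym (f≤g zero)
  (+-cancelʳ-≤ (sum (g ∘ suc)) (g zero) (f zero)
    (≤-trans g≤f (+-monoʳ-≤ (f zero) (sum-mono (f≤g ∘ suc)))))
sum-tight {suc n} {f} {g} f≤g g≤f (suc i) = sum-tight (f≤g ∘ suc)
  (+-cancelˡ-≤ (g zero) (sum (g ∘ suc)) (sum (f ∘ suc))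
    (≤-trans g≤f (+-monoˡ-≤ (sum (f ∘ suc)) (f≤g zero)))) i

count-∷ : ∀ {A : Set} (p : A → Bool) x xs → count p (x ∷ xs) ≡ 𝟙 (p x) + count p xs
count-∷ p x xs with p x
... | true  = refl
... | false = refl

count-++ : ∀ {A : Set} (p : A → Bool) xs ys → count p (xs ++ ys) ≡ count p xs + count p ys
count-++ p []       ys = refl
count-++ p (x ∷ xs) ys with p x
... | true  = cong suc (count-++ p xs ys)
... | false = count-++ p xs ys

count-map : ∀ {A B : Set} (p : B → Bool) (g : A → B) xs → count p (map g xs) ≡ count (p ∘ g) xs
count-map p g []       = refl
count-map p g (x ∷ xs) with p (g x)
... | true  = cong suc (count-map p g xs)
... | false = count-map p g xs

count-tabulate : ∀ {A : Set} {n} (p : A → Bool) (f : Fin n → A) →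
  count p (tabulate f) ≡ ∑[ i < n ] 𝟙 (p (f i))
count-tabulate {n = zero}  p f = refl
count-tabulate {n = suc n} p f =
  trans (count-∷ p (f zero) (tabulate (f ∘ suc))) (cong (𝟙 (p (f zero)) +_) (count-tabulate p (f ∘ suc)))

count-allFin : ∀ {n} (p : Fin n → Bool) → count p (allFin n) ≡ ∑[ i < n ] 𝟙 (p i)
count-allFin p = count-tabulate p id

count-product : ∀ {A B : Set} {n} (p : A × B → Bool) (f : Fin n → A) (ys : List B) →
  count p (cartesianProduct (tabulate f) ys) ≡ ∑[ i < n ] count (λ y → p (f i , y)) ys
count-product {n = zero}  p f ys = refl
count-product {n = suc n} p f ys = trans (count-++ p (map (f zero ,_) ys) _)
  (cong₂ _+_ (count-map p (f zero ,_) ys) (count-product p (f ∘ suc) ys))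

-- An edge of H covered by S is counted at its A-endpoint if that lies in S,
-- and otherwise at its B-endpoint.
count-cover : ∀ {A : Set} (c s : A → Bool) a xs →
  count (λ x → c x ∧ (a ∨ s x)) xs ≤ 𝟙 a * count c xs + count (λ x → c x ∧ s x) xs
count-cover c s a [] = z≤n
count-cover {A} c s a (x ∷ xs) = begin
  count P (x ∷ xs)
    ≡⟨ count-∷ P x xs ⟩
  𝟙 (P x) + count P xs
    ≤⟨ +-mono-≤ (𝟙-cover (c x) a (s x)) (count-cover c s a xs) ⟩
  (𝟙 a * 𝟙 (c x) + 𝟙 (Q x)) + (𝟙 a * count c xs + count Q xs)
    ≡⟨ regroup (𝟙 a) (𝟙 (c x)) (𝟙 (Q x)) (count c xs) (count Q xs) ⟩
  𝟙 a * (𝟙 (c x) + count c xs) + (𝟙 (Q x) + count Q xs)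
    ≡⟨ cong₂ (λ u v → 𝟙 a * u + v) (count-∷ c x xs) (count-∷ Q x xs) ⟨
  𝟙 a * count c (x ∷ xs) + count Q (x ∷ xs) ∎
  where
  open ≤-Reasoning
  P Q : A → Bool
  P x = c x ∧ (a ∨ s x)
  Q x = c x ∧ s x
  𝟙-cover : ∀ c a s → 𝟙 (c ∧ (a ∨ s)) ≤ 𝟙 a * 𝟙 c + 𝟙 (c ∧ s)
  𝟙-cover true  true  s     = m≤m+n 1 (𝟙 s)
  𝟙-cover true  false s     = ≤-refl
  𝟙-cover false a     s     = z≤n
  regroup : ∀ a b c d e → (a * b + c) + (a * d + e) ≡ a * (b + d) + (c + e)
  regroup = solve-∀

count-allHB : ∀ n m r (p : HB n m r → Bool) → count p (allHB n m r) ≡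
  ∑[ v < n ] 𝟙 (p (inj₁ v)) + ∑[ i < m ] ∑[ j < r ∸ 3 ] 𝟙 (p (inj₂ (i , j)))
count-allHB n m r p = begin
  count p (map inj₁ (allFin n) ++ map inj₂ Π)
    ≡⟨ count-++ p (map inj₁ (allFin n)) (map inj₂ Π) ⟩
  count p (map inj₁ (allFin n)) + count p (map inj₂ Π)
    ≡⟨ cong₂ _+_ (trans (count-map p inj₁ (allFin n)) (count-allFin (p ∘ inj₁)))
                 (trans (count-map p inj₂ Π) (count-product (p ∘ inj₂) id (allFin (r ∸ 3)))) ⟩
  ∑[ v < n ] 𝟙 (p (inj₁ v)) + ∑[ i < m ] count (λ j → p (inj₂ (i , j))) (allFin (r ∸ 3))
    ≡⟨ cong (∑[ v < n ] 𝟙 (p (inj₁ v)) +_) (sum-cong-≗ (λ i → count-allFin (λ j → p (inj₂ (i , j))))) ⟩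
  ∑[ v < n ] 𝟙 (p (inj₁ v)) + ∑[ i < m ] ∑[ j < r ∸ 3 ] 𝟙 (p (inj₂ (i , j))) ∎
  where
  open ≡-Reasoning
  Π = cartesianProduct (allFin m) (allFin (r ∸ 3))

count-allHV : ∀ n m r (p : HV n m r → Bool) →
  count p (allHV n m r) ≡ ∑[ i < m ] 𝟙 (p (inj₁ i)) + count (p ∘ inj₂) (allHB n m r)
count-allHV n m r p = trans (count-++ p (map inj₁ (allFin m)) (map inj₂ (allHB n m r)))
  (cong₂ _+_ (trans (count-map p inj₁ (allFin m)) (count-allFin (p ∘ inj₁)))
             (count-map p inj₂ (allHB n m r)))

incidence-sum : ∀ {n m} (G : Graph n m) i (w : Fin n → ℕ) →
  ∑[ v < n ] (𝟙 (incidentᵇ G i v) * w v) ≡ w (end₁ G i) + w (end₂ G i)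
incidence-sum {n} G i w = begin
  ∑[ v < n ] (𝟙 (incidentᵇ G i v) * w v)
    ≡⟨ sum-cong-≗ (λ v → trans (cong (_* w v) (𝟙-∨ _ _ (ends-distinct v)))
                               (*-distribʳ-+ (w v) (δ x v) (δ y v))) ⟩
  ∑[ v < n ] (δ x v * w v + δ y v * w v)
    ≡⟨ ∑-distrib-+ (λ v → δ x v * w v) (λ v → δ y v * w v) ⟩
  ∑[ v < n ] (δ x v * w v) + ∑[ v < n ] (δ y v * w v)
    ≡⟨ cong₂ _+_ (sum-δ x w) (sum-δ y w) ⟩
  w x + w y ∎
  where
  open ≡-Reasoning
  x y : Fin n
  x = end₁ G i
  y = end₂ G i
  ends-distinct : ∀ v → 1 ≤ δ x v → 1 ≤ δ y v → ⊥
  ends-distinct v x≡v y≡v = loopless G i (trans (δ-sound x≡v) (sym (δ-sound y≡v)))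

degree-sum : ∀ {n m} (G : Graph n m) (w : Fin n → ℕ) →
  ∑[ v < n ] (w v * degree G v) ≡ ∑[ i < m ] (w (end₁ G i) + w (end₂ G i))
degree-sum {n} {m} G w = begin
  ∑[ v < n ] (w v * degree G v)
    ≡⟨ sum-cong-≗ (λ v → trans (cong (w v *_) (count-allFin (λ i → incidentᵇ G i v)))
                               (sym (sum-*ˡ (w v) (λ i → 𝟙 (incidentᵇ G i v))))) ⟩
  ∑[ v < n ] ∑[ i < m ] (w v * 𝟙 (incidentᵇ G i v))
    ≡⟨ ∑-comm (λ v i → w v * 𝟙 (incidentᵇ G i v)) ⟩
  ∑[ i < m ] ∑[ v < n ] (w v * 𝟙 (incidentᵇ G i v))
    ≡⟨ sum-cong-≗ (λ i → trans (sum-cong-≗ (λ v → *-comm (w v) (𝟙 (incidentᵇ G i v))))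
                               (incidence-sum G i w)) ⟩
  ∑[ i < m ] (w (end₁ G i) + w (end₂ G i)) ∎
  where open ≡-Reasoning

regular-sum : ∀ {n m r} (G : Graph n m) → Regular G r → (w : Fin n → ℕ) →
  sum w * r ≡ ∑[ i < m ] (w (end₁ G i) + w (end₂ G i))
regular-sum {n} {r = r} G reg w = begin
  sum w * r                      ≡⟨ *-distribʳ-sum r w ⟩
  ∑[ v < n ] (w v * r)           ≡⟨ sum-cong-≗ (λ v → cong (w v *_) (reg v)) ⟨
  ∑[ v < n ] (w v * degree G v)  ≡⟨ degree-sum G w ⟩
  ∑[ i < _ ] (w (end₁ G i) + w (end₂ G i)) ∎
  where open ≡-Reasoning

handshake : ∀ {n m r} (G : Graph n m) → Regular G r → m + m ≡ n * r
handshake {n} {m} {r} G reg = begin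
  m + m                  ≡⟨ cong (m +_) (+-identityʳ m) ⟨
  2 * m                  ≡⟨ *-comm 2 m ⟩
  m * 2                  ≡⟨ sum-const m 2 ⟨
  ∑[ i < m ] 2           ≡⟨ regular-sum G reg (λ _ → 1) ⟨
  (∑[ v < n ] 1) * r     ≡⟨ cong (_* r) (trans (sum-const n 1) (*-identityʳ n)) ⟩
  n * r                  ∎
  where open ≡-Reasoning

C2-suc : ∀ k → suc k C 2 ≡ k + k C 2
C2-suc k = trans (sym (nCk+nC[k+1]≡[n+1]C[k+1] k 1)) (cong (_+ k C 2) (nC1≡n k))

precedes-once : ∀ {n} (u v : Fin n) → u ≢ v → 𝟙 (toℕ u <ᵇ toℕ v) + 𝟙 (toℕ v <ᵇ toℕ u) ≡ 1
precedes-once zero    zero    u≢v = ⊥-elim (u≢v refl)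
precedes-once zero    (suc v) _   = refl
precedes-once (suc u) zero    _   = refl
precedes-once (suc u) (suc v) u≢v = precedes-once u v (u≢v ∘ cong suc)

ordered-pairs : ∀ {n} (X : Fin n → Bool) →
  ∑[ u < n ] ∑[ v < n ] (𝟙 (toℕ u <ᵇ toℕ v) * 𝟙 (X u ∧ X v)) ≡ (∑[ v < n ] 𝟙 (X v)) C 2
ordered-pairs {zero}  X = refl
ordered-pairs {suc n} X = begin
  ∑[ v < n ] (1 * 𝟙 (X zero ∧ X (suc v)))
    + ∑[ u < n ] ∑[ v < n ] (𝟙 (toℕ u <ᵇ toℕ v) * 𝟙 (X (suc u) ∧ X (suc v)))
    ≡⟨ cong₂ _+_ pairs-with-first (ordered-pairs (X ∘ suc)) ⟩
  𝟙 (X zero) * k + k C 2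
    ≡⟨ add-first (X zero) ⟩
  (𝟙 (X zero) + k) C 2 ∎
  where
  open ≡-Reasoning
  k : ℕ
  k = ∑[ v < n ] 𝟙 (X (suc v))
  pairs-with-first : ∑[ v < n ] (1 * 𝟙 (X zero ∧ X (suc v))) ≡ 𝟙 (X zero) * k
  pairs-with-first = trans (sum-cong-≗ (λ v → trans (*-identityˡ _) (𝟙-∧ (X zero) (X (suc v)))))
                           (sum-*ˡ (𝟙 (X zero)) (λ v → 𝟙 (X (suc v))))
  add-first : ∀ b → 𝟙 b * k + k C 2 ≡ (𝟙 b + k) C 2
  add-first true  = trans (cong (_+ k C 2) (*-identityˡ k)) (sym (C2-suc k))
  add-first false = refl

enumerate : ∀ {n} (X : Fin n → Bool) → Σ (Fin (∑[ v < n ] 𝟙 (X v)) → Fin n) λ f →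
  Injective _≡_ _≡_ f × (∀ a → X (f a) ≡ true)
enumerate {zero}  X = (λ ()) , (λ {}) , (λ ())
enumerate {suc n} X with X zero in X0 | enumerate (X ∘ suc)
... | false | f , f-injective , f∈X = suc ∘ f , f-injective ∘ suc-injective , f∈X
... | true  | f , f-injective , f∈X = g , g-injective , g∈X
  where
  g : Fin (suc (∑[ v < n ] 𝟙 (X (suc v)))) → Fin (suc n)
  g zero    = zero
  g (suc a) = suc (f a)
  g-injective : Injective _≡_ _≡_ g
  g-injective {zero}  {zero}  _  = refl
  g-injective {zero}  {suc _} ()
  g-injective {suc _} {zero}  ()
  g-injective {suc a} {suc b} eq = cong suc (f-injective (suc-injective eq))
  g∈X : ∀ a → X (g a) ≡ true
  g∈X zero    = X0
  g∈X (suc a) = f∈X a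

module VertexSubset {n m} (G : Graph n m) (X : Fin n → Bool) where

  ∣X∣ inside avoiding : ℕ
  ∣X∣      = ∑[ v < n ] 𝟙 (X v)
  inside   = ∑[ i < m ] 𝟙 (X (end₁ G i) ∧ X (end₂ G i))
  avoiding = ∑[ i < m ] 𝟙 (not (X (end₁ G i)) ∧ not (X (end₂ G i)))

  ∣X∣≤n : ∣X∣ ≤ n
  ∣X∣≤n = ≤-trans (sum-mono (λ v → 𝟙≤1 (X v))) (≤-reflexive (trans (sum-const n 1) (*-identityʳ n)))

  ends-in-X : ∀ {r} → Regular G r → ∑[ i < m ] (𝟙 (X (end₁ G i)) + 𝟙 (X (end₂ G i))) ≡ ∣X∣ * r
  ends-in-X reg = sym (regular-sum G reg (𝟙 ∘ X))

  -- Sorting the edges by their number of ends in X: m + e(X) = (edges avoiding X) + |X|·r.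
  edge-balance : ∀ {r} → Regular G r → m + inside ≡ avoiding + ∣X∣ * r
  edge-balance {r} reg = begin
    m + inside
      ≡⟨ cong (_+ inside) (trans (sum-const m 1) (*-identityʳ m)) ⟨
    ∑[ i < m ] 1 + inside
      ≡⟨ ∑-distrib-+ (λ _ → 1) (λ i → 𝟙 (x i ∧ y i)) ⟨
    ∑[ i < m ] (1 + 𝟙 (x i ∧ y i))
      ≡⟨ sum-cong-≗ (λ i → end-types (x i) (y i)) ⟩
    ∑[ i < m ] (𝟙 (not (x i) ∧ not (y i)) + (𝟙 (x i) + 𝟙 (y i)))
      ≡⟨ ∑-distrib-+ (λ i → 𝟙 (not (x i) ∧ not (y i))) (λ i → 𝟙 (x i) + 𝟙 (y i)) ⟩
    avoiding + ∑[ i < m ] (𝟙 (x i) + 𝟙 (y i))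
      ≡⟨ cong (avoiding +_) (ends-in-X reg) ⟩
    avoiding + ∣X∣ * r ∎
    where
    open ≡-Reasoning
    x y : Fin m → Bool
    x i = X (end₁ G i)
    y i = X (end₂ G i)
    end-types : ∀ a b → 1 + 𝟙 (a ∧ b) ≡ 𝟙 (not a ∧ not b) + (𝟙 a + 𝟙 b)
    end-types true  true  = refl
    end-types true  false = refl
    end-types false true  = refl
    end-types false false = refl

  -- Each edge inside X contributes 2 to the degree sum over X: 2e(X) ≤ |X|·r.
  inside-degree : ∀ {r} → Regular G r → 2 * inside ≤ ∣X∣ * r
  inside-degree {r} reg = begin
    2 * inside
      ≡⟨ sum-*ˡ 2 (λ i → 𝟙 (x i ∧ y i)) ⟨
    ∑[ i < m ] (2 * 𝟙 (x i ∧ y i))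
      ≤⟨ sum-mono (λ i → both-ends (x i) (y i)) ⟩
    ∑[ i < m ] (𝟙 (x i) + 𝟙 (y i))
      ≡⟨ ends-in-X reg ⟩
    ∣X∣ * r ∎
    where
    open ≤-Reasoning
    x y : Fin m → Bool
    x i = X (end₁ G i)
    y i = X (end₂ G i)
    both-ends : ∀ a b → 2 * 𝟙 (a ∧ b) ≤ 𝟙 a + 𝟙 b
    both-ends true  true  = ≤-refl
    both-ends true  false = z≤n
    both-ends false b     = z≤n

  ordered-pair : Fin n → Fin n → ℕ
  ordered-pair u v = 𝟙 (toℕ u <ᵇ toℕ v) * 𝟙 (X u ∧ X v)

  Joins : Fin m → Fin n → Fin n → Set
  Joins i u v = (end₁ G i ≡ u × end₂ G i ≡ v) ⊎ (end₁ G i ≡ v × end₂ G i ≡ u)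

  joins? : ∀ i u v → Dec (Joins i u v)
  joins? i u v = (end₁ G i ≟ u ×-dec end₂ G i ≟ v) ⊎-dec (end₁ G i ≟ v ×-dec end₂ G i ≟ u)

  multiplicity : Fin n → Fin n → ℕ
  multiplicity u v = ∑[ i < m ] 𝟙 (does (joins? i u v))

  multiplicity≤1 : ∀ u v → multiplicity u v ≤ 1
  multiplicity≤1 u v = sum≤1 (λ i → 𝟙 (does (joins? i u v))) (λ i → 𝟙≤1 (does (joins? i u v)))
    (λ i j i-joins j-joins → same-ends i j (𝟙-does (joins? i u v) i-joins) (𝟙-does (joins? j u v) j-joins))
    where
    same-ends : ∀ i j → Joins i u v → Joins j u v → i ≡ j
    same-ends i j (inj₁ (a , b)) (inj₁ (c , d)) = noMulti G i j (inj₁ (trans a (sym c) , trans b (sym d)))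
    same-ends i j (inj₁ (a , b)) (inj₂ (c , d)) = noMulti G i j (inj₂ (trans a (sym d) , trans b (sym c)))
    same-ends i j (inj₂ (a , b)) (inj₁ (c , d)) = noMulti G i j (inj₂ (trans a (sym d) , trans b (sym c)))
    same-ends i j (inj₂ (a , b)) (inj₂ (c , d)) = noMulti G i j (inj₁ (trans a (sym c) , trans b (sym d)))

  multiplicity-adjacent : ∀ u v → 1 ≤ multiplicity u v → Adj G u v
  multiplicity-adjacent u v h with sum-positive (λ i → 𝟙 (does (joins? i u v))) h
  ... | i , i-joins = i , 𝟙-does (joins? i u v) i-joins

  -- As G is loopless, edge i joins u and v in at most one orientation.
  𝟙-joins : ∀ i u v → 𝟙 (does (joins? i u v)) ≡
    δ (end₁ G i) u * δ (end₂ G i) v + δ (end₂ G i) u * δ (end₁ G i) v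
  𝟙-joins i u v = begin
    𝟙 (does (joins? i u v))
      ≡⟨ 𝟙-∨ (does forward) (does backward) one-orientation ⟩
    𝟙 (does forward) + 𝟙 (does backward)
      ≡⟨ cong₂ _+_ (𝟙-∧ (does (x ≟ u)) (does (y ≟ v)))
                   (trans (𝟙-∧ (does (x ≟ v)) (does (y ≟ u))) (*-comm (δ x v) (δ y u))) ⟩
    δ x u * δ y v + δ y u * δ x v ∎
    where
    open ≡-Reasoning
    x y : Fin n
    x = end₁ G i
    y = end₂ G i
    forward : Dec (x ≡ u × y ≡ v)
    forward = x ≟ u ×-dec y ≟ v
    backward : Dec (x ≡ v × y ≡ u)
    backward = x ≟ v ×-dec y ≟ u
    one-orientation : 1 ≤ 𝟙 (does forward) → 1 ≤ 𝟙 (does backward) → ⊥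
    one-orientation p q with 𝟙-does forward p | 𝟙-does backward q
    ... | x≡u , _ | _ , y≡u = loopless G i (trans x≡u (sym y≡u))

  edge-as-pair : ∀ i → 𝟙 (X (end₁ G i) ∧ X (end₂ G i)) ≡
    ∑[ u < n ] ∑[ v < n ] (ordered-pair u v * 𝟙 (does (joins? i u v)))
  edge-as-pair i = sym (begin
    ∑[ u < n ] ∑[ v < n ] (ordered-pair u v * 𝟙 (does (joins? i u v)))
      ≡⟨ sum-cong-≗ (λ u → sum-cong-≗ (λ v → trans (cong (ordered-pair u v *_) (𝟙-joins i u v))
           (*-distribˡ-+ (ordered-pair u v) (δ x u * δ y v) (δ y u * δ x v)))) ⟩
    ∑[ u < n ] ∑[ v < n ] (ordered-pair u v * (δ x u * δ y v) + ordered-pair u v * (δ y u * δ x v))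
      ≡⟨ sum-cong-≗ (λ u → ∑-distrib-+ (λ v → ordered-pair u v * (δ x u * δ y v))
                                       (λ v → ordered-pair u v * (δ y u * δ x v))) ⟩
    ∑[ u < n ] (∑[ v < n ] (ordered-pair u v * (δ x u * δ y v))
                + ∑[ v < n ] (ordered-pair u v * (δ y u * δ x v)))
      ≡⟨ ∑-distrib-+ (λ u → ∑[ v < n ] (ordered-pair u v * (δ x u * δ y v)))
                     (λ u → ∑[ v < n ] (ordered-pair u v * (δ y u * δ x v))) ⟩
    ∑[ u < n ] ∑[ v < n ] (ordered-pair u v * (δ x u * δ y v))
      + ∑[ u < n ] ∑[ v < n ] (ordered-pair u v * (δ y u * δ x v))
      ≡⟨ cong₂ _+_ (sum-δ₂ x y ordered-pair) (sum-δ₂ y x ordered-pair) ⟩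
    𝟙 (toℕ x <ᵇ toℕ y) * 𝟙 (X x ∧ X y) + 𝟙 (toℕ y <ᵇ toℕ x) * 𝟙 (X y ∧ X x)
      ≡⟨ cong (λ b → 𝟙 (toℕ x <ᵇ toℕ y) * 𝟙 (X x ∧ X y) + 𝟙 (toℕ y <ᵇ toℕ x) * 𝟙 b) (∧-comm (X y) (X x)) ⟩
    𝟙 (toℕ x <ᵇ toℕ y) * 𝟙 (X x ∧ X y) + 𝟙 (toℕ y <ᵇ toℕ x) * 𝟙 (X x ∧ X y)
      ≡⟨ *-distribʳ-+ (𝟙 (X x ∧ X y)) (𝟙 (toℕ x <ᵇ toℕ y)) (𝟙 (toℕ y <ᵇ toℕ x)) ⟨
    (𝟙 (toℕ x <ᵇ toℕ y) + 𝟙 (toℕ y <ᵇ toℕ x)) * 𝟙 (X x ∧ X y)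
      ≡⟨ cong (_* 𝟙 (X x ∧ X y)) (precedes-once x y (loopless G i)) ⟩
    1 * 𝟙 (X x ∧ X y)
      ≡⟨ *-identityˡ (𝟙 (X x ∧ X y)) ⟩
    𝟙 (X x ∧ X y) ∎)
    where
    open ≡-Reasoning
    x y : Fin n
    x = end₁ G i
    y = end₂ G i

  inside-as-pairs : inside ≡ ∑[ u < n ] ∑[ v < n ] (ordered-pair u v * multiplicity u v)
  inside-as-pairs = begin
    inside
      ≡⟨ sum-cong-≗ edge-as-pair ⟩
    ∑[ i < m ] ∑[ u < n ] ∑[ v < n ] (ordered-pair u v * 𝟙 (does (joins? i u v)))
      ≡⟨ ∑-comm (λ i u → ∑[ v < n ] (ordered-pair u v * 𝟙 (does (joins? i u v)))) ⟩
    ∑[ u < n ] ∑[ i < m ] ∑[ v < n ] (ordered-pair u v * 𝟙 (does (joins? i u v)))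
      ≡⟨ sum-cong-≗ (λ u → ∑-comm (λ i v → ordered-pair u v * 𝟙 (does (joins? i u v)))) ⟩
    ∑[ u < n ] ∑[ v < n ] ∑[ i < m ] (ordered-pair u v * 𝟙 (does (joins? i u v)))
      ≡⟨ sum-cong-≗ (λ u → sum-cong-≗ (λ v → sum-*ˡ (ordered-pair u v) (λ i → 𝟙 (does (joins? i u v))))) ⟩
    ∑[ u < n ] ∑[ v < n ] (ordered-pair u v * multiplicity u v) ∎
    where open ≡-Reasoning

  pair-bound : ∀ u v → ordered-pair u v * multiplicity u v ≤ ordered-pair u v
  pair-bound u v = ≤-trans (*-monoʳ-≤ (ordered-pair u v) (multiplicity≤1 u v))
                           (≤-reflexive (*-identityʳ (ordered-pair u v)))

  inside≤pairs : inside ≤ ∣X∣ C 2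
  inside≤pairs = begin
    inside                                               ≡⟨ inside-as-pairs ⟩
    ∑[ u < n ] ∑[ v < n ] (ordered-pair u v * multiplicity u v)
      ≤⟨ sum-mono (λ u → sum-mono (pair-bound u)) ⟩
    ∑[ u < n ] ∑[ v < n ] ordered-pair u v               ≡⟨ ordered-pairs X ⟩
    ∣X∣ C 2                                              ∎
    where open ≤-Reasoning

  saturated⇒clique : ∣X∣ C 2 ≤ inside → HasClique G ∣X∣
  saturated⇒clique saturated with enumerate X
  ... | f , f-injective , f∈X =
    f , f-injective , λ a b a≢b → adjacent (f a) (f b) (a≢b ∘ f-injective) (f∈X a) (f∈X b)
    where
    all-pairs-joined : ∀ u v → ordered-pair u v * multiplicity u v ≡ ordered-pair u v
    all-pairs-joined u = sum-tight (pair-bound u)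
      (≤-reflexive (sym (sum-tight (λ u → sum-mono (pair-bound u))
        (begin
          ∑[ u < n ] ∑[ v < n ] ordered-pair u v  ≡⟨ ordered-pairs X ⟩
          ∣X∣ C 2                                  ≤⟨ saturated ⟩
          inside                                   ≡⟨ inside-as-pairs ⟩
          ∑[ u < n ] ∑[ v < n ] (ordered-pair u v * multiplicity u v) ∎)
        u)))
      where open ≤-Reasoning
    adjacent-in-order : ∀ u v → (toℕ u <ᵇ toℕ v) ≡ true → X u ≡ true → X v ≡ true → Adj G u v
    adjacent-in-order u v u<v u∈X v∈X = multiplicity-adjacent u v
      (≤-reflexive (trans (sym (trans (all-pairs-joined u v) pair≡1))
                          (trans (cong (_* multiplicity u v) pair≡1) (*-identityˡ (multiplicity u v)))))
      where
      pair≡1 : ordered-pair u v ≡ 1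
      pair≡1 rewrite u<v | u∈X | v∈X = refl
    adjacent : ∀ u v → u ≢ v → X u ≡ true → X v ≡ true → Adj G u v
    adjacent u v u≢v u∈X v∈X with toℕ u <ᵇ toℕ v in u<v | toℕ v <ᵇ toℕ u in v<u | precedes-once u v u≢v
    ... | true  | _    | _ = adjacent-in-order u v u<v u∈X v∈X
    ... | false | true | _ = Product.map id swap (adjacent-in-order v u v<u v∈X u∈X)
      where
      swap : ∀ {i} → Joins i v u → Joins i u v
      swap (inj₁ p) = inj₂ p
      swap (inj₂ p) = inj₁ p

  no-clique⇒sparse : ¬ HasClique G ∣X∣ → inside < ∣X∣ C 2
  no-clique⇒sparse no-clique = ≰⇒> (no-clique ∘ saturated⇒clique)

module VertexSetOfH {n m} (G : Graph n m) (r : ℕ) (S : VSet n m r) where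

  inA : Fin m → Bool
  inA i = S (inj₁ i)

  inβ : Fin n → Bool
  inβ v = S (inj₂ (inj₁ v))

  inΠ : Fin m → Fin (r ∸ 3) → Bool
  inΠ i j = S (inj₂ (inj₂ (i , j)))

  α β π : ℕ
  α = ∑[ i < m ] 𝟙 (inA i)
  β = ∑[ v < n ] 𝟙 (inβ v)
  π = ∑[ i < m ] ∑[ j < r ∸ 3 ] 𝟙 (inΠ i j)

  size-split : size {n} {m} {r} S ≡ α + (β + π)
  size-split = trans (count-allHV n m r S) (cong (α +_) (count-allHB n m r (S ∘ inj₂)))

  -- Every a_i has degree 2 + (r - 3) in H: the two ends of e_i and its r - 3 pendant vertices.
  degree-a : ∀ i → count (HAdjᵇ G r i) (allHB n m r) ≡ 2 + (r ∸ 3)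
  degree-a i = begin
    count (HAdjᵇ G r i) (allHB n m r)
      ≡⟨ count-allHB n m r (HAdjᵇ G r i) ⟩
    ∑[ v < n ] 𝟙 (incidentᵇ G i v) + ∑[ i′ < m ] ∑[ j < r ∸ 3 ] δ i i′
      ≡⟨ cong₂ _+_ ends pendants ⟩
    2 + (r ∸ 3) ∎
    where
    open ≡-Reasoning
    ends : ∑[ v < n ] 𝟙 (incidentᵇ G i v) ≡ 2
    ends = trans (sum-cong-≗ (λ v → sym (*-identityʳ (𝟙 (incidentᵇ G i v))))) (incidence-sum G i (λ _ → 1))
    pendants : ∑[ i′ < m ] ∑[ j < r ∸ 3 ] δ i i′ ≡ r ∸ 3
    pendants = trans (sum-cong-≗ (λ i′ → trans (sum-const (r ∸ 3) (δ i i′)) (*-comm (r ∸ 3) (δ i i′))))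
                     (sum-δ i (λ _ → r ∸ 3))

  -- Each b_v has degree r in H and each p_{i,j} degree 1, so the edges
  -- of H at B-vertices of S number β·r + π.
  edges-at-B : Regular G r → ∑[ i < m ] count (λ b → HAdjᵇ G r i b ∧ S (inj₂ b)) (allHB n m r) ≡ β * r + π
  edges-at-B reg = begin
    ∑[ i < m ] count (λ b → HAdjᵇ G r i b ∧ S (inj₂ b)) (allHB n m r)
      ≡⟨ sum-cong-≗ (λ i → trans (count-allHB n m r (λ b → HAdjᵇ G r i b ∧ S (inj₂ b)))
                                  (cong₂ _+_ (at-β i) (at-Π i))) ⟩
    ∑[ i < m ] ((𝟙 (inβ (end₁ G i)) + 𝟙 (inβ (end₂ G i))) + ∑[ j < r ∸ 3 ] 𝟙 (inΠ i j))
      ≡⟨ ∑-distrib-+ (λ i → 𝟙 (inβ (end₁ G i)) + 𝟙 (inβ (end₂ G i))) (λ i → ∑[ j < r ∸ 3 ] 𝟙 (inΠ i j)) ⟩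
    ∑[ i < m ] (𝟙 (inβ (end₁ G i)) + 𝟙 (inβ (end₂ G i))) + π
      ≡⟨ cong (_+ π) (regular-sum G reg (𝟙 ∘ inβ)) ⟨
    β * r + π ∎
    where
    open ≡-Reasoning
    at-β : ∀ i → ∑[ v < n ] 𝟙 (incidentᵇ G i v ∧ inβ v) ≡ 𝟙 (inβ (end₁ G i)) + 𝟙 (inβ (end₂ G i))
    at-β i = trans (sum-cong-≗ (λ v → 𝟙-∧ (incidentᵇ G i v) (inβ v))) (incidence-sum G i (𝟙 ∘ inβ))
    at-Π : ∀ i → ∑[ i′ < m ] ∑[ j < r ∸ 3 ] 𝟙 (does (i ≟ i′) ∧ inΠ i′ j) ≡ ∑[ j < r ∸ 3 ] 𝟙 (inΠ i j)
    at-Π i = trans (sum-cong-≗ (λ i′ → trans (sum-cong-≗ (λ j → 𝟙-∧ (does (i ≟ i′)) (inΠ i′ j)))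
                                             (sum-*ˡ (δ i i′) (λ j → 𝟙 (inΠ i′ j)))))
                   (sum-δ i (λ i′ → ∑[ j < r ∸ 3 ] 𝟙 (inΠ i′ j)))

  -- Charging every covered edge to an endpoint in S: cov(S) ≤ Σ_{s ∈ S} deg_H(s).
  cover-bound : Regular G r → covered G r S ≤ α * (2 + (r ∸ 3)) + (β * r + π)
  cover-bound reg = begin
    covered G r S
      ≡⟨ count-product {n = m} _ id (allHB n m r) ⟩
    ∑[ i < m ] count (λ b → HAdjᵇ G r i b ∧ (inA i ∨ S (inj₂ b))) (allHB n m r)
      ≤⟨ sum-mono (λ i → count-cover (HAdjᵇ G r i) (S ∘ inj₂) (inA i) (allHB n m r)) ⟩
    ∑[ i < m ] (𝟙 (inA i) * count (HAdjᵇ G r i) (allHB n m r) + count (λ b → HAdjᵇ G r i b ∧ S (inj₂ b)) (allHB n m r))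
      ≡⟨ ∑-distrib-+ (λ i → 𝟙 (inA i) * count (HAdjᵇ G r i) (allHB n m r))
                     (λ i → count (λ b → HAdjᵇ G r i b ∧ S (inj₂ b)) (allHB n m r)) ⟩
    ∑[ i < m ] (𝟙 (inA i) * count (HAdjᵇ G r i) (allHB n m r)) + ∑[ i < m ] count (λ b → HAdjᵇ G r i b ∧ S (inj₂ b)) (allHB n m r)
      ≡⟨ cong₂ _+_ (trans (sum-cong-≗ (λ i → cong (𝟙 (inA i) *_) (degree-a i)))
                          (sym (*-distribʳ-sum (2 + (r ∸ 3)) (𝟙 ∘ inA))))
                   (edges-at-B reg) ⟩
    α * (2 + (r ∸ 3)) + (β * r + π) ∎
    where open ≤-Reasoning

  -- If S is independent, a_i ∈ S forces both ends of e_i out of S: α ≤ #(edges avoiding S ∩ β).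
  independent-avoids : Independent G r S → α ≤ VertexSubset.avoiding G inβ
  independent-avoids independent = sum-mono λ i → excluded (inA i) (inβ (end₁ G i)) (inβ (end₂ G i))
    (independent i (inj₁ (end₁ G i)) (incident-end₁ i)) (independent i (inj₁ (end₂ G i)) (incident-end₂ i))
    where
    excluded : ∀ a x y → a ∧ x ≡ false → a ∧ y ≡ false → 𝟙 a ≤ 𝟙 (not x ∧ not y)
    excluded true  false false _ _ = ≤-refl
    excluded false x     y     _ _ = z≤n
    incident-end₁ : ∀ i → incidentᵇ G i (end₁ G i) ≡ true
    incident-end₁ i = cong (_∨ does (end₂ G i ≟ end₁ G i)) (dec-true (end₁ G i ≟ end₁ G i) refl)
    incident-end₂ : ∀ i → incidentᵇ G i (end₂ G i) ≡ true
    incident-end₂ i = trans (cong (does (end₁ G i ≟ end₂ G i) ∨_) (dec-true (end₂ G i ≟ end₂ G i) refl))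
                            (∨-zeroʳ (does (end₁ G i ≟ end₂ G i)))

exceeds : ∀ {a b} w → b + suc w ≡ a → ¬ (a ≤ b)
exceeds {a} {b} w b+1+w≡a a≤b = m+1+n≰m b (subst (_≤ b) (sym b+1+w≡a) a≤b)

C2-double : ∀ k → 2 * (k C 2) + k ≡ k * k
C2-double zero    = refl
C2-double (suc k) = begin
  2 * (suc k C 2) + suc k         ≡⟨ cong (λ z → 2 * z + suc k) (C2-suc k) ⟩
  2 * (k + k C 2) + suc k         ≡⟨ regroup k (k C 2) ⟩
  (2 * (k C 2) + k) + (2 * k + 1) ≡⟨ cong (_+ (2 * k + 1)) (C2-double k) ⟩
  k * k + (2 * k + 1)             ≡⟨ square k ⟩
  suc k * suc k                   ∎
  where
  open ≡-Reasoning
  regroup : ∀ k c → 2 * (k + c) + suc k ≡ (2 * c + k) + (2 * k + 1)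
  regroup = solve-∀
  square : ∀ k → k * k + (2 * k + 1) ≡ suc k * suc k
  square = solve-∀

-- ... and pairs of a (k + d)-set are inside the k-part, across, or inside the d-part.
C2-+ : ∀ k d → (k + d) C 2 ≡ k C 2 + k * d + d C 2
C2-+ zero    d = refl
C2-+ (suc k) d = begin
  suc (k + d) C 2                     ≡⟨ C2-suc (k + d) ⟩
  (k + d) + (k + d) C 2               ≡⟨ cong ((k + d) +_) (C2-+ k d) ⟩
  (k + d) + (k C 2 + k * d + d C 2)   ≡⟨ regroup k d (k C 2) (d C 2) ⟩
  (k + k C 2) + suc k * d + d C 2     ≡⟨ cong (λ z → z + suc k * d + d C 2) (C2-suc k) ⟨
  suc k C 2 + suc k * d + d C 2       ∎
  where
  open ≡-Reasoning
  regroup : ∀ k d c e → (k + d) + (c + k * d + e) ≡ (k + c) + suc k * d + e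
  regroup = solve-∀

∸-∸-+ : ∀ {m b c} → c ≤ b → b ≤ m → m ∸ (b ∸ c) + b ≡ m + c
∸-∸-+ {m} {b} {c} c≤b b≤m = begin
  m ∸ (b ∸ c) + b             ≡⟨ cong (m ∸ (b ∸ c) +_) (m∸n+n≡m c≤b) ⟨
  m ∸ (b ∸ c) + (b ∸ c + c)   ≡⟨ +-assoc (m ∸ (b ∸ c)) (b ∸ c) c ⟨
  m ∸ (b ∸ c) + (b ∸ c) + c   ≡⟨ cong (_+ c) (m∸n+n≡m (≤-trans (m∸n≤m b c) b≤m)) ⟩
  m + c                       ∎
  where open ≡-Reasoning

-- Weighing the size equation α + β + π = k + x by p + 1 against the cover
-- inequality leaves k + pπ ≤ β.
excess-bound : ∀ p k x α β π → α + (β + π) ≡ k + x →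
  k * (2 + p) + x * (1 + p) ≤ α * (1 + p) + (β * (2 + p) + π) → k + p * π ≤ β
excess-bound p k x α β π size cover = +-cancelˡ-≤ ((1 + p) * (k + x)) (k + p * π) β (begin
  (1 + p) * (k + x) + (k + p * π)            ≡⟨ left p k x π ⟩
  (k * (2 + p) + x * (1 + p)) + p * π        ≤⟨ +-monoˡ-≤ (p * π) cover ⟩
  (α * (1 + p) + (β * (2 + p) + π)) + p * π  ≡⟨ right p α β π ⟩
  (1 + p) * (α + (β + π)) + β                ≡⟨ cong (λ z → (1 + p) * z + β) size ⟩
  (1 + p) * (k + x) + β                      ∎)
  where
  open ≤-Reasoning
  left : ∀ p k x π → (1 + p) * (k + x) + (k + p * π) ≡ (k * (2 + p) + x * (1 + p)) + p * π
  left = solve-∀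
  right : ∀ p α β π → (α * (1 + p) + (β * (2 + p) + π)) + p * π ≡ (1 + p) * (α + (β + π)) + β
  right = solve-∀

few-new-vertices : ∀ d s → 1 ≤ d → d ≤ s + 1 → 3 ≤ s → ¬ (d * s ≤ d + 1 + d C 2)
few-new-vertices 1 s _ _ 3≤s h = exceeds 0 refl (≤-trans 3≤s (≤-trans (m≤m+n s 0) h))
few-new-vertices 2 s _ _ 3≤s h = exceeds 1 refl (≤-trans (*-monoʳ-≤ 2 3≤s) h)
few-new-vertices d@(suc (suc (suc d′))) s _ d≤s+1 3≤s h =
  exceeds d′ (gap d′) (≤-trans (*-monoʳ-≤ d 3≤s) ds≤2d+2)
  where
  open ≤-Reasoning
  ds≤2d+2 : d * s ≤ 2 * d + 2
  ds≤2d+2 = +-cancelʳ-≤ (d * s + d) (d * s) (2 * d + 2) (begin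
    d * s + (d * s + d)          ≡⟨ doubled d s ⟩
    2 * (d * s) + d              ≤⟨ +-monoˡ-≤ d (*-monoʳ-≤ 2 h) ⟩
    2 * (d + 1 + d C 2) + d      ≡⟨ spread d (d C 2) ⟩
    (2 * d + 2) + (2 * (d C 2) + d) ≡⟨ cong ((2 * d + 2) +_) (C2-double d) ⟩
    (2 * d + 2) + d * d          ≤⟨ +-monoʳ-≤ (2 * d + 2) (*-monoʳ-≤ d d≤s+1) ⟩
    (2 * d + 2) + d * (s + 1)    ≡⟨ distribute d s ⟩
    (2 * d + 2) + (d * s + d)    ∎)
    where
    doubled : ∀ d s → d * s + (d * s + d) ≡ 2 * (d * s) + d
    doubled = solve-∀
    spread : ∀ d c → 2 * (d + 1 + c) + d ≡ (2 * d + 2) + (2 * c + d)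
    spread = solve-∀
    distribute : ∀ d s → (2 * d + 2) + d * (s + 1) ≡ (2 * d + 2) + (d * s + d)
    distribute = solve-∀
  gap : ∀ d′ → (2 * (3 + d′) + 2) + suc d′ ≡ (3 + d′) * 3
  gap = solve-∀

many-new-vertices : ∀ k d s c e → 2 * c + k ≡ k * k → 3 ≤ s → s + 1 < d →
  c + d * (k + s) ≤ d + 1 + e → 2 * e ≤ (k + d) * (k + s) → ⊥
many-new-vertices k d s c e 2c+k≡k² (s≤s (s≤s (s≤s (z≤n {s′})))) s+1<d h 2e≤ =
  exceeds (k + u * k + 2 + 6 * s′ + s′ * s′ + u + u * s′) gap cleared
  where
  open ≤-Reasoning
  cleared : k * k + 2 * (d * (k + s)) ≤ (2 * d + 2 + k) + (k + d) * (k + s)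
  cleared = begin
    k * k + 2 * (d * (k + s))        ≡⟨ cong (_+ 2 * (d * (k + s))) 2c+k≡k² ⟨
    2 * c + k + 2 * (d * (k + s))    ≡⟨ regroup c k (d * (k + s)) ⟩
    2 * (c + d * (k + s)) + k        ≤⟨ +-monoˡ-≤ k (*-monoʳ-≤ 2 h) ⟩
    2 * (d + 1 + e) + k              ≡⟨ spread d e k ⟩
    (2 * d + 2 + k) + 2 * e          ≤⟨ +-monoʳ-≤ (2 * d + 2 + k) 2e≤ ⟩
    (2 * d + 2 + k) + (k + d) * (k + s) ∎
    where
    regroup : ∀ c k y → 2 * c + k + 2 * y ≡ 2 * (c + y) + k
    regroup = solve-∀
    spread : ∀ d e k → 2 * (d + 1 + e) + k ≡ (2 * d + 2 + k) + 2 * e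
    spread = solve-∀
  u : ℕ
  u = d ∸ suc (s + 1)
  gap : (2 * d + 2 + k) + (k + d) * (k + s) + suc (k + u * k + 2 + 6 * s′ + s′ * s′ + u + u * s′)
      ≡ k * k + 2 * (d * (k + s))
  gap = subst (λ d → (2 * d + 2 + k) + (k + d) * (k + s) + suc (k + u * k + 2 + 6 * s′ + s′ * s′ + u + u * s′)
                   ≡ k * k + 2 * (d * (k + s)))
              (m+[n∸m]≡n s+1<d) (polynomial k u s′)
    where
    polynomial : ∀ k u s′ → let s = 3 + s′ ; d = suc (s + 1) + u in
      (2 * d + 2 + k) + (k + d) * (k + s) + suc (k + u * k + 2 + 6 * s′ + s′ * s′ + u + u * s′)
        ≡ k * k + 2 * (d * (k + s))
    polynomial = solve-∀

-- With n = 12 + t and r = 8 + t, the quantities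
-- α = |S ∩ A|, β = |S ∩ β|, π = |S ∩ Π|, N = #(edges avoiding S ∩ β) and
-- e = #(edges inside S ∩ β) cannot satisfy all the constraints derived from
-- G and S at once.
module Core (t m k α β π N e : ℕ)
  (k≥1          : 1 ≤ k)
  (2k<n         : 2 * k < 12 + t)
  (handshake    : m + m ≡ (12 + t) * (8 + t))
  (edge-balance : m + e ≡ N + β * (8 + t))
  (α≤N          : α ≤ N)
  (2e≤βr        : 2 * e ≤ β * (8 + t))
  (e≤βC2        : e ≤ β C 2)
  (no-clique    : β ≡ k → e < k C 2)
  (β≤n          : β ≤ 12 + t)
  (size         : α + (β + π) ≡ k + (m ∸ (k * (8 + t) ∸ k C 2)))
  (cover        : k * (8 + t) + (m ∸ (k * (8 + t) ∸ k C 2)) * (7 + t)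
                    ≤ α * (7 + t) + (β * (8 + t) + π))
  where

  r c x : ℕ
  r = 8 + t
  c = k C 2
  x = m ∸ (k * r ∸ c)

  k≤5+t : k ≤ 5 + t
  k≤5+t = ≮⇒≥ λ 5+t<k → <⇒≱ 2k<n (begin
    12 + t         ≤⟨ m≤m+n (12 + t) t ⟩
    12 + t + t     ≡⟨ double t ⟩
    2 * (6 + t)    ≤⟨ *-monoʳ-≤ 2 5+t<k ⟩
    2 * k          ∎)
    where
    open ≤-Reasoning
    double : ∀ t → 12 + t + t ≡ 2 * (6 + t)
    double = solve-∀

  -- Besides the k chosen vertices, every vertex has s ≥ 3 further neighbours: r = k + s.
  s : ℕ
  s = 3 + (5 + t ∸ k)

  r≡k+s : r ≡ k + s
  r≡k+s = trans (cong (3 +_) (sym (m+[n∸m]≡n k≤5+t))) (shift k (5 + t ∸ k))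
    where
    shift : ∀ a b → 3 + (a + b) ≡ a + (3 + b)
    shift = solve-∀

  -- kr ≤ nr/2 = m and (k choose 2) ≤ k² ≤ kr, so the truncated subtraction in x is exact.
  kr≤m : k * r ≤ m
  kr≤m = *-cancelˡ-≤ 2 (begin
    2 * (k * r)    ≡⟨ *-assoc 2 k r ⟨
    2 * k * r      ≤⟨ *-monoˡ-≤ r (<⇒≤ 2k<n) ⟩
    (12 + t) * r   ≡⟨ handshake ⟨
    m + m          ≡⟨ cong (m +_) (+-identityʳ m) ⟨
    2 * m          ∎)
    where open ≤-Reasoning

  c≤kr : c ≤ k * r
  c≤kr = begin
    c              ≤⟨ m≤m+n c (c + k) ⟩
    c + (c + k)    ≡⟨ twice c k ⟩
    2 * c + k      ≡⟨ C2-double k ⟩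
    k * k          ≤⟨ *-monoʳ-≤ k (≤-trans k≤5+t (m≤n+m (5 + t) 3)) ⟩
    k * r          ∎
    where
    open ≤-Reasoning
    twice : ∀ c k → c + (c + k) ≡ 2 * c + k
    twice = solve-∀

  excess : k + (6 + t) * π ≤ β
  excess = excess-bound (6 + t) k x α β π size cover

  d a : ℕ
  d = β ∸ k
  a = N ∸ α

  β≡k+d : β ≡ k + d
  β≡k+d = sym (m+[n∸m]≡n (≤-trans (m≤m+n k ((6 + t) * π)) excess))

  -- Eliminating α, x and m from the three counting identities.
  balance : d + π + e ≡ c + a + d * r
  balance = +-cancelˡ-≡ (α + k + x + m + k * r) (d + π + e) (c + a + d * r) (begin
    (α + k + x + m + k * r) + (d + π + e)
      ≡⟨ gather α k d π x (k * r) m e ⟩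
    (α + ((k + d) + π)) + (x + k * r) + (m + e)
      ≡⟨ cong (λ b → (α + (b + π)) + (x + k * r) + (m + e)) β≡k+d ⟨
    (α + (β + π)) + (x + k * r) + (m + e)
      ≡⟨ cong₂ (λ u v → u + v + (m + e)) size (∸-∸-+ c≤kr kr≤m) ⟩
    (k + x) + (m + c) + (m + e)
      ≡⟨ cong ((k + x) + (m + c) +_) edge-balance ⟩
    (k + x) + (m + c) + (N + β * r)
      ≡⟨ cong₂ (λ u v → (k + x) + (m + c) + (u + v * r)) (sym (m+[n∸m]≡n α≤N)) β≡k+d ⟩
    (k + x) + (m + c) + ((α + a) + (k + d) * r)
      ≡⟨ scatter α k d x (k * r) m c a r ⟩
    (α + k + x + m + k * r) + (c + a + d * r) ∎)
    where
    open ≡-Reasoning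
    gather : ∀ α k d π x y m e → (α + k + x + m + y) + (d + π + e) ≡ (α + ((k + d) + π)) + (x + y) + (m + e)
    gather = solve-∀
    scatter : ∀ α k d x y m c a r → (k + x) + (m + c) + ((α + a) + (k + d) * r) ≡ (α + k + x + m + k * r) + (c + a + d * r)
    scatter = solve-∀

  π-bounded : ∀ q → d < (6 + t) * q → π < q
  π-bounded q d<6q = *-cancelˡ-< (6 + t) π q
    (≤-<-trans (+-cancelˡ-≤ k ((6 + t) * π) d (subst (k + (6 + t) * π ≤_) β≡k+d excess)) d<6q)

  -- ... and d < n - 1 < 2(r - 2), so S contains at most one vertex of Π.
  π≤1 : π ≤ 1
  π≤1 = s≤s⁻¹ (π-bounded 2 (begin-strict
    d                ≤⟨ +-cancelˡ-≤ 1 d (11 + t) (≤-trans (+-monoˡ-≤ d k≥1) (subst (_≤ 12 + t) β≡k+d β≤n)) ⟩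
    11 + t           <⟨ n<1+n (11 + t) ⟩
    12 + t           ≤⟨ m≤m+n (12 + t) t ⟩
    12 + t + t       ≡⟨ double t ⟩
    (6 + t) * 2      ∎))
    where
    open ≤-Reasoning
    double : ∀ t → 12 + t + t ≡ (6 + t) * 2
    double = solve-∀

  -- d = 0: then π = 0, and S ∩ β is a k-set spanning at least (k choose 2) edges.
  no-new-vertex : d ≡ 0 → ⊥
  no-new-vertex d≡0 = <⇒≱ (no-clique β≡k) (begin
    c                ≤⟨ m≤m+n c (a + d * r) ⟩
    c + (a + d * r)  ≡⟨ +-assoc c a (d * r) ⟨
    c + a + d * r    ≡⟨ balance ⟨
    d + π + e        ≡⟨ cong₂ (λ u v → u + v + e) d≡0 π≡0 ⟩
    e                ∎)
    where
    open ≤-Reasoning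
    π≡0 : π ≡ 0
    π≡0 = n<1⇒n≡0 (π-bounded 1 (subst (_< (6 + t) * 1) (sym d≡0) (s≤s z≤n)))
    β≡k : β ≡ k
    β≡k = trans β≡k+d (trans (cong (k +_) d≡0) (+-identityʳ k))

  -- d ≥ 1: π ≤ 1, so the d new vertices carry almost all of the surplus.
  surplus : c + d * (k + s) ≤ d + 1 + e
  surplus = begin
    c + d * (k + s)   ≡⟨ cong (λ z → c + d * z) r≡k+s ⟨
    c + d * r         ≤⟨ +-monoˡ-≤ (d * r) (m≤m+n c a) ⟩
    c + a + d * r     ≡⟨ balance ⟨
    d + π + e         ≤⟨ +-monoˡ-≤ e (+-monoʳ-≤ d π≤1) ⟩
    d + 1 + e         ∎
    where open ≤-Reasoning

  -- Compare the surplus with e ≤ (k + d choose 2) if d ≤ s + 1, and with 2e ≤ (k + d)r otherwise.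
  some-new-vertex : 1 ≤ d → ⊥
  some-new-vertex 1≤d with d ≤? s + 1
  ... | yes d≤s+1 = few-new-vertices d s 1≤d d≤s+1 (m≤m+n 3 _)
    (+-cancelˡ-≤ (c + k * d) (d * s) (d + 1 + d C 2) (begin
      c + k * d + d * s           ≡⟨ split c k d s ⟩
      c + d * (k + s)             ≤⟨ surplus ⟩
      d + 1 + e                   ≤⟨ +-monoʳ-≤ (d + 1) (subst (λ b → e ≤ b C 2) β≡k+d e≤βC2) ⟩
      d + 1 + (k + d) C 2         ≡⟨ cong (d + 1 +_) (C2-+ k d) ⟩
      d + 1 + (c + k * d + d C 2) ≡⟨ shuffle d c (k * d) (d C 2) ⟩
      c + k * d + (d + 1 + d C 2) ∎))
    where
    open ≤-Reasoning
    split : ∀ c k d s → c + k * d + d * s ≡ c + d * (k + s)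
    split = solve-∀
    shuffle : ∀ d c y z → d + 1 + (c + y + z) ≡ c + y + (d + 1 + z)
    shuffle = solve-∀
  ... | no d≰s+1 = many-new-vertices k d s c e (C2-double k) (m≤m+n 3 _) (≰⇒> d≰s+1) surplus
    (subst₂ (λ u v → 2 * e ≤ u * v) β≡k+d r≡k+s 2e≤βr)

  impossible : ⊥
  impossible with 1 ≤? d
  ... | yes 1≤d = some-new-vertex 1≤d
  ... | no  d≱1 = no-new-vertex (n<1⇒n≡0 (≰⇒> d≱1))

lemma5 : (n : ℕ) → 11 < n → (m : ℕ) → (G : Graph n m) →
    Regular G (n ∸ 4) →
    (k : ℕ) → 0 < k → 2 * k < n →
    ¬ HasClique G k →
    (S : VSet n m (n ∸ 4)) → Independent G (n ∸ 4) S →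
    size {n} {m} {n ∸ 4} S ≡ k + (m ∸ (k * (n ∸ 4) ∸ (k C 2))) →
    ¬ (k * (n ∸ 4) + (m ∸ (k * (n ∸ 4) ∸ (k C 2))) * ((n ∸ 4) ∸ 1) ≤ covered G (n ∸ 4) S)
lemma5 n 11<n m G regular k k≥1 2k<n no-k-clique S independent size≡ covers with m≤n⇒∃[o]m+o≡n 11<n
... | t , refl = Core.impossible t m k H.α H.β H.π X.avoiding X.inside
  k≥1 2k<n (handshake G regular) (X.edge-balance regular) (H.independent-avoids independent)
  (X.inside-degree regular) X.inside≤pairs no-k-clique-in-β X.∣X∣≤n
  (trans (sym H.size-split) size≡) (≤-trans covers (H.cover-bound regular))
  where
  module H = VertexSetOfH G (8 + t) S
  module X = VertexSubset G H.inβ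
  no-k-clique-in-β : H.β ≡ k → X.inside < k C 2
  no-k-clique-in-β refl = X.no-clique⇒sparse no-k-clique
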